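{- Let $\Delta$ be a pure simplicial complex on vertex set $[n]$ with codimension $c=n-\dim\Delta-1$, and suppose $\overline{e}(\Delta)\le 2c-1$. Then: (1) any vertex of $\Delta$ that is contained in at least $c$ antifacets is a shedding vertex; (2) if $w$ is a vertex that is not a shedding vertex, and $F$ is a facet of $\Delta$ with $w\in F$ such that for each vertex $u\notin F$ the set $(F\setminus\{w\})\cup\{u\}$ is an antifacet, then every vertex $v\in F\setminus\{w\}$ is contained in (at least) $c$ antifacets, and in particular is a shedding vertex.
   Context: A simplicial complex on vertex set $[n]$ contains $\{i\}$ as a face for every $i\in[n]$. $\Delta$ is pure if all facets have the same cardinality; $\dim F=|F|-1$. An antifacet of $\Delta$ is a subset of $[n]$ of cardinality $\dim\Delta+1$ that is not a face of $\Delta$, and $\overline{e}(\Delta)$ is the number of antifacets. A vertex $x$ is a shedding vertex if for every facet $F$ of $\Delta$ with $x\in F$ there is a vertex $y\notin F$ such that $(F\setminus\{x\})\cup\{y\}\in\Delta$. -}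

module Defs where

open import Data.Nat using (ℕ; zero; suc; _⊔_; _≡ᵇ_)
open import Data.Bool using (Bool; true; false; T; _∧_; not)
open import Data.List using (List; []; _∷_; map; _++_; foldr; length; filter)
open import Data.Vec using (_∷_; [])
open import Data.Fin using (Fin)
open import Data.Fin.Subset using (Subset; inside; outside; ⁅_⁆; _∈_; _∉_; _⊆_; _∪_; _-_; ∣_∣; ⊥)
open import Data.Fin.Subset.Properties using (_∈?_)
open import Data.Product using (Σ; ∃; _×_)
open import Relation.Nullary using (¬_; Dec; yes; no)
open import Relation.Nullary.Decidable using (T?)
open import Relation.Binary.PropositionalEquality using (_≡_)

record SimplicialComplex (n : ℕ) : Set where
  field
    face     : Subset n → Bool
    empty    : T (face ⊥)
    vertices : ∀ (i : Fin n) → T (face ⁅ i ⁆)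
    down     : ∀ {σ τ : Subset n} → σ ⊆ τ → T (face τ) → T (face σ)
open SimplicialComplex public

IsFace : ∀ {n} → SimplicialComplex n → Subset n → Set
IsFace Δ σ = T (face Δ σ)

IsFacet : ∀ {n} → SimplicialComplex n → Subset n → Set
IsFacet Δ F = IsFace Δ F × (∀ τ → F ⊆ τ → IsFace Δ τ → τ ≡ F)

Pure : ∀ {n} → SimplicialComplex n → Set
Pure Δ = ∀ F G → IsFacet Δ F → IsFacet Δ G → ∣ F ∣ ≡ ∣ G ∣

allSubsets : ∀ n → List (Subset n)
allSubsets zero = [] ∷ []
allSubsets (suc n) = map (inside ∷_) (allSubsets n) ++ map (outside ∷_) (allSubsets n)

-- dim Δ + 1 = maximal cardinality of a face (natural number, avoids dim = -1)
dimPlus1 : ∀ {n} → SimplicialComplex n → ℕ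
dimPlus1 {n} Δ = foldr (λ σ m → (if face Δ σ then ∣ σ ∣ else 0) ⊔ m) 0 (allSubsets n)
  where
  if_then_else_ : Bool → ℕ → ℕ → ℕ
  if true then a else b = a
  if false then a else b = b

codim : ∀ {n} → SimplicialComplex n → ℕ
codim {n} Δ = n Data.Nat.∸ dimPlus1 Δ

IsAntifacet : ∀ {n} → SimplicialComplex n → Subset n → Set
IsAntifacet Δ σ = (∣ σ ∣ ≡ dimPlus1 Δ) × ¬ IsFace Δ σ

isAntifacetᵇ : ∀ {n} → SimplicialComplex n → Subset n → Bool
isAntifacetᵇ Δ σ = (∣ σ ∣ ≡ᵇ dimPlus1 Δ) ∧ not (face Δ σ)

antifacetCount : ∀ {n} → SimplicialComplex n → ℕ
antifacetCount {n} Δ = length (filter (λ σ → T? (isAntifacetᵇ Δ σ)) (allSubsets n))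

antifacetsContaining : ∀ {n} → SimplicialComplex n → Fin n → ℕ
antifacetsContaining {n} Δ x =
  length (filter (λ σ → T? (isAntifacetᵇ Δ σ ∧ memb σ)) (allSubsets n))
  where
  memb : Subset n → Bool
  memb σ with x ∈? σ
  ... | yes _ = true
  ... | no _ = false

IsSheddingVertex : ∀ {n} → SimplicialComplex n → Fin n → Set
IsSheddingVertex {n} Δ x =
  ∀ F → IsFacet Δ F → x ∈ F → ∃ λ (y : Fin n) → y ∉ F × IsFace Δ ((F - x) ∪ ⁅ y ⁆)

-- For a facet F of the pure complex Δ, the exchanges (F ∖ {x}) ∪ {y}, y ∉ F, are
-- ∣∁ F∣ = c distinct sets of size dim Δ + 1.  If x is not shedding, then for some
-- facet F ∋ x none of them is a face, so they are c antifacets avoiding x; together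
-- with c antifacets containing x this gives 2c ≤ ē(Δ), a contradiction.  In (2) the
-- exchanges of w are c antifacets containing every v ∈ F ∖ {w}, so (1) applies to v.
module Submission where

open import Defs
open import Data.Bool using (Bool; true; false; T; _∧_; not)
open import Data.Bool.Properties using (T-∧)
open import Data.Empty using (⊥-elim)
open import Data.Fin using (Fin; zero; suc)
import Data.Fin.Properties as Fin
open import Data.Fin.Subset
  using (Subset; inside; outside; _∈_; _∉_; _⊆_; _∪_; _-_; ⁅_⁆; ∣_∣; ∁)
  renaming (⊥ to ∅)
open import Data.Fin.Subset.Properties
open import Data.List using (List; []; _∷_; map; foldr; length; filter)
open import Data.List.Properties using (length-map; length-removeAt′)
import Data.List.Membership.Propositional as List
open import Data.List.Membership.Propositional using (_─_)
open import Data.List.Membership.Propositional.Properties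
  using (∈-map⁻; ∈-map⁺; ∈-++⁺ˡ; ∈-++⁺ʳ; ∈-filter⁺)
import Data.List.Relation.Unary.All as All
import Data.List.Relation.Unary.All.Properties as All
open import Data.List.Relation.Unary.Any as Any using (index)
open import Data.List.Relation.Unary.AllPairs using ([]; _∷_)
open import Data.List.Relation.Unary.Unique.Propositional using (Unique)
import Data.List.Relation.Unary.Unique.Propositional.Properties as Unique
open import Data.Nat using (ℕ; suc; _+_; _*_; _∸_; _⊔_; _≤_; z≤n; s≤s)
open import Data.Nat.Properties
  using (≤-trans; ≤-reflexive; <-irrefl; ≤⇒≯; +-mono-≤; +-identityʳ; +-suc; ⊔-sel; m≤m⊔n; m≤n⊔m; ≡⇒≡ᵇ; module ≤-Reasoning)
open import Data.Product using (Σ; ∃; _×_; _,_; proj₁)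
open import Data.Sum using (_⊎_; inj₁; inj₂)
open import Data.Vec.Base using ([]; _∷_; here; there)
open import Function using (_∘_)
open import Function.Bundles using (Equivalence)
open import Relation.Nullary using (¬_; yes; no; contradiction)
open import Relation.Nullary.Decidable using (T?; ¬?; _×-dec_)
open import Relation.Binary.PropositionalEquality
  using (_≡_; _≢_; refl; sym; trans; cong; subst)

private variable
  A B : Set
  n : ℕ

¬T⇒T-not : ∀ {b} → ¬ T b → T (not b)
¬T⇒T-not {true}  ¬t = ¬t _
¬T⇒T-not {false} _  = _

T-∧-intro : ∀ {a b} → T a → T b → T (a ∧ b)
T-∧-intro ta tb = Equivalence.from T-∧ (ta , tb)

∈-─⁺ : ∀ {x y : A} {xs} (x∈xs : x List.∈ xs) → y List.∈ xs → y ≢ x → y List.∈ xs ─ x∈xs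
∈-─⁺ (Any.here refl)  (Any.here refl)  y≢x = ⊥-elim (y≢x refl)
∈-─⁺ (Any.here refl)  (Any.there y∈xs) _   = y∈xs
∈-─⁺ (Any.there _)    (Any.here y≡x)   _   = Any.here y≡x
∈-─⁺ (Any.there x∈xs) (Any.there y∈xs) y≢x = Any.there (∈-─⁺ x∈xs y∈xs y≢x)

length-≤-injectiveOn : ∀ (f : A → B) {xs ys} → Unique xs →
  (∀ {a b} → a List.∈ xs → b List.∈ xs → f a ≡ f b → a ≡ b) →
  (∀ {a} → a List.∈ xs → f a List.∈ ys) →
  length xs ≤ length ys
length-≤-injectiveOn f {[]} _ _ _ = z≤n
length-≤-injectiveOn f {a ∷ xs} {ys} (a∉xs ∷ unique) injective into =
  ≤-trans (s≤s (length-≤-injectiveOn f unique (λ p q → injective (Any.there p) (Any.there q)) into′))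
          (≤-reflexive (sym (length-removeAt′ ys (index fa∈ys))))
  where
  fa∈ys : f a List.∈ ys
  fa∈ys = into (Any.here refl)
  into′ : ∀ {b} → b List.∈ xs → f b List.∈ ys ─ fa∈ys
  into′ b∈xs = ∈-─⁺ fa∈ys (into (Any.there b∈xs)) λ fb≡fa →
    All.lookup a∉xs b∈xs (sym (injective (Any.there b∈xs) (Any.here refl) fb≡fa))

length-filter-∧-split : ∀ (a m : A → Bool) xs →
  length (filter (λ x → T? (a x)) xs) ≡
    length (filter (λ x → T? (a x ∧ m x)) xs) + length (filter (λ x → T? (a x ∧ not (m x))) xs)
length-filter-∧-split a m [] = refl
length-filter-∧-split a m (x ∷ xs) with a x | m x
... | true  | true  = cong suc (length-filter-∧-split a m xs)
... | true  | false = trans (cong suc (length-filter-∧-split a m xs)) (sym (+-suc _ _))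
... | false | _     = length-filter-∧-split a m xs

maxOver : (A → ℕ) → List A → ℕ
maxOver h = foldr (λ x m → h x ⊔ m) 0

maxOver-upperBound : ∀ (h : A → ℕ) {x xs} → x List.∈ xs → h x ≤ maxOver h xs
maxOver-upperBound h {xs = x ∷ xs} (Any.here refl) = m≤m⊔n (h x) _
maxOver-upperBound h {xs = y ∷ xs} (Any.there x∈xs) =
  ≤-trans (maxOver-upperBound h x∈xs) (m≤n⊔m (h y) _)

maxOver-attained : ∀ (h : A → ℕ) xs → maxOver h xs ≡ 0 ⊎ ∃ λ x → h x ≡ maxOver h xs
maxOver-attained h [] = inj₁ refl
maxOver-attained h (x ∷ xs) with ⊔-sel (h x) (maxOver h xs)
... | inj₁ max≡hx = inj₂ (x , sym max≡hx)
... | inj₂ max≡rest with maxOver-attained h xs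
...   | inj₁ rest≡0        = inj₁ (trans max≡rest rest≡0)
...   | inj₂ (y , hy≡rest) = inj₂ (y , trans hy≡rest (sym max≡rest))

elements : Subset n → List (Fin n)
elements []            = []
elements (inside  ∷ p) = zero ∷ map suc (elements p)
elements (outside ∷ p) = map suc (elements p)

length-elements : ∀ (p : Subset n) → length (elements p) ≡ ∣ p ∣
length-elements []            = refl
length-elements (inside  ∷ p) = cong suc (trans (length-map suc (elements p)) (length-elements p))
length-elements (outside ∷ p) = trans (length-map suc (elements p)) (length-elements p)

∈-elements⁻ : ∀ (p : Subset n) {x} → x List.∈ elements p → x ∈ p
∈-elements⁻ (inside ∷ p) (Any.here refl) = here
∈-elements⁻ (inside ∷ p) (Any.there x∈) with ∈-map⁻ suc x∈
... | _ , x∈p , refl = there (∈-elements⁻ p x∈p)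
∈-elements⁻ (outside ∷ p) x∈ with ∈-map⁻ suc x∈
... | _ , x∈p , refl = there (∈-elements⁻ p x∈p)

elements-unique : ∀ (p : Subset n) → Unique (elements p)
elements-unique []            = []
elements-unique (inside  ∷ p) =
  All.map⁺ (All.universal (λ _ ()) (elements p)) ∷ Unique.map⁺ Fin.suc-injective (elements-unique p)
elements-unique (outside ∷ p) = Unique.map⁺ Fin.suc-injective (elements-unique p)

∈-allSubsets : ∀ (σ : Subset n) → σ List.∈ allSubsets n
∈-allSubsets []            = Any.here refl
∈-allSubsets (inside  ∷ σ) = ∈-++⁺ˡ (∈-map⁺ (inside ∷_) (∈-allSubsets σ))
∈-allSubsets {suc n} (outside ∷ σ) =
  ∈-++⁺ʳ (map (inside ∷_) (allSubsets n)) (∈-map⁺ (outside ∷_) (∈-allSubsets σ))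

⊆∧∣q∣≤∣p∣⇒q⊆p : ∀ {p q : Subset n} → p ⊆ q → ∣ q ∣ ≤ ∣ p ∣ → q ⊆ p
⊆∧∣q∣≤∣p∣⇒q⊆p {p = p} p⊆q ∣q∣≤∣p∣ {x} x∈q with x ∈? p
... | yes x∈p = x∈p
... | no  x∉p = contradiction (p⊂q⇒∣p∣<∣q∣ (p⊆q , x , x∈q , x∉p)) (≤⇒≯ ∣q∣≤∣p∣)

∣p∪⁅x⁆∣≡1+∣p∣ : ∀ (p : Subset n) {x} → x ∉ p → ∣ p ∪ ⁅ x ⁆ ∣ ≡ suc ∣ p ∣
∣p∪⁅x⁆∣≡1+∣p∣ (inside  ∷ p) {zero}  x∉p = ⊥-elim (x∉p here)
∣p∪⁅x⁆∣≡1+∣p∣ (outside ∷ p) {zero}  _   = cong (suc ∘ ∣_∣) (∪-identityʳ p)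
∣p∪⁅x⁆∣≡1+∣p∣ (inside  ∷ p) {suc x} x∉p = cong suc (∣p∪⁅x⁆∣≡1+∣p∣ p (x∉p ∘ there))
∣p∪⁅x⁆∣≡1+∣p∣ (outside ∷ p) {suc x} x∉p = ∣p∪⁅x⁆∣≡1+∣p∣ p (x∉p ∘ there)

1+∣p-x∣≡∣p∣ : ∀ (p : Subset n) {x} → x ∈ p → suc ∣ p - x ∣ ≡ ∣ p ∣
1+∣p-x∣≡∣p∣ (inside ∷ p) {zero}  _           = cong (suc ∘ ∣_∣) (p─⊥≡p p)
1+∣p-x∣≡∣p∣ (inside ∷ p) {suc x} (there x∈p) = cong suc (1+∣p-x∣≡∣p∣ p x∈p)
1+∣p-x∣≡∣p∣ (outside ∷ p) {suc x} (there x∈p) = 1+∣p-x∣≡∣p∣ p x∈p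

x∉p-x : ∀ (p : Subset n) x → x ∉ p - x
x∉p-x (_ ∷ p) zero    ()
x∉p-x (_ ∷ p) (suc x) (there x∈p-x) = x∉p-x p x x∈p-x

exchange : Subset n → Fin n → Fin n → Subset n
exchange p x y = (p - x) ∪ ⁅ y ⁆

∣exchange∣≡∣p∣ : ∀ (p : Subset n) {x y} → x ∈ p → y ∉ p → ∣ exchange p x y ∣ ≡ ∣ p ∣
∣exchange∣≡∣p∣ p {x} x∈p y∉p =
  trans (∣p∪⁅x⁆∣≡1+∣p∣ (p - x) (y∉p ∘ p─q⊆p p ⁅ x ⁆)) (1+∣p-x∣≡∣p∣ p x∈p)

exchange-injective : ∀ (p : Subset n) x {a b} → a ∉ p → exchange p x a ≡ exchange p x b → a ≡ b
exchange-injective p x {a} {b} a∉p eq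
  with x∈p∪q⁻ (p - x) ⁅ b ⁆ (subst (a ∈_) eq (x∈p∪q⁺ (inj₂ (x∈⁅x⁆ a))))
... | inj₁ a∈p-x = ⊥-elim (a∉p (p─q⊆p p ⁅ x ⁆ a∈p-x))
... | inj₂ a∈⁅b⁆ = x∈⁅y⁆⇒x≡y b a∈⁅b⁆

x∉exchange : ∀ (p : Subset n) {x y} → y ≢ x → x ∉ exchange p x y
x∉exchange p {x} {y} y≢x x∈ with x∈p∪q⁻ (p - x) ⁅ y ⁆ x∈
... | inj₁ x∈p-x = x∉p-x p x x∈p-x
... | inj₂ x∈⁅y⁆ = y≢x (sym (x∈⁅y⁆⇒x≡y y x∈⁅y⁆))

count : (Subset n → Bool) → ℕ
count {n} b = length (filter (λ σ → T? (b σ)) (allSubsets n))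

count-split : ∀ (a m : Subset n → Bool) →
  count a ≡ count (λ σ → a σ ∧ m σ) + count (λ σ → a σ ∧ not (m σ))
count-split {n} a m = length-filter-∧-split a m (allSubsets n)

∣∁p∣≤count-exchanges : ∀ (p : Subset n) x (b : Subset n → Bool) →
  (∀ y → y ∉ p → T (b (exchange p x y))) → ∣ ∁ p ∣ ≤ count b
∣∁p∣≤count-exchanges p x b exchange∈b =
  subst (_≤ count b) (length-elements (∁ p))
    (length-≤-injectiveOn (exchange p x) (elements-unique (∁ p))
      (λ a∈ _ → exchange-injective p x (outside-p a∈))
      (λ a∈ → ∈-filter⁺ _ (∈-allSubsets _) (exchange∈b _ (outside-p a∈))))
  where
  outside-p : ∀ {a} → a List.∈ elements (∁ p) → a ∉ p
  outside-p = x∈∁p⇒x∉p ∘ ∈-elements⁻ (∁ p)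

-- `dimPlus1` and `antifacetsContaining` are built from where-bound functions, which
-- cannot be referred to by name; they are recovered here through unification.
private
  faceSize-as-fold : (Δ : SimplicialComplex n) →
    Σ (Subset n → ℕ) λ h → dimPlus1 Δ ≡ maxOver h (allSubsets n)
  faceSize-as-fold Δ = _ , refl

  containsᵇ-as-filter : (Δ : SimplicialComplex n) (x : Fin n) →
    Σ (Subset n → Bool) λ m → antifacetsContaining Δ x ≡ count (λ σ → isAntifacetᵇ Δ σ ∧ m σ)
  containsᵇ-as-filter Δ x = _ , refl

faceSize : SimplicialComplex n → Subset n → ℕ
faceSize Δ = proj₁ (faceSize-as-fold Δ)

containsᵇ : SimplicialComplex n → Fin n → Subset n → Bool
containsᵇ Δ x = proj₁ (containsᵇ-as-filter Δ x)

module _ (Δ : SimplicialComplex n) where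

  faceSize-face : ∀ {σ} → IsFace Δ σ → faceSize Δ σ ≡ ∣ σ ∣
  faceSize-face {σ} σ∈Δ with face Δ σ
  ... | true = refl

  faceSize-nonface : ∀ {σ} → ¬ IsFace Δ σ → faceSize Δ σ ≡ 0
  faceSize-nonface {σ} σ∉Δ with face Δ σ
  ... | true  = ⊥-elim (σ∉Δ _)
  ... | false = refl

  containsᵇ-∈ : ∀ {x σ} → x ∈ σ → T (containsᵇ Δ x σ)
  containsᵇ-∈ {x} {σ} x∈σ with x ∈? σ
  ... | yes _   = _
  ... | no  x∉σ = x∉σ x∈σ

  containsᵇ-∉ : ∀ {x σ} → x ∉ σ → T (not (containsᵇ Δ x σ))
  containsᵇ-∉ {x} {σ} x∉σ with x ∈? σ
  ... | yes x∈σ = x∉σ x∈σ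
  ... | no  _   = _

  antifacetCount-split : ∀ x → antifacetCount Δ ≡
    antifacetsContaining Δ x + count (λ σ → isAntifacetᵇ Δ σ ∧ not (containsᵇ Δ x σ))
  antifacetCount-split x = count-split (isAntifacetᵇ Δ) (containsᵇ Δ x)

  isAntifacetᵇ-complete : ∀ {σ} → IsAntifacet Δ σ → T (isAntifacetᵇ Δ σ)
  isAntifacetᵇ-complete (size , σ∉Δ) = T-∧-intro (≡⇒≡ᵇ _ _ size) (¬T⇒T-not σ∉Δ)

  ∣face∣≤dimPlus1 : ∀ {σ} → IsFace Δ σ → ∣ σ ∣ ≤ dimPlus1 Δ
  ∣face∣≤dimPlus1 {σ} σ∈Δ = subst (_≤ dimPlus1 Δ) (faceSize-face σ∈Δ)
    (maxOver-upperBound (faceSize Δ) (∈-allSubsets σ))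

  face-of-size-dimPlus1 : ∃ λ σ → IsFace Δ σ × ∣ σ ∣ ≡ dimPlus1 Δ
  face-of-size-dimPlus1 with maxOver-attained (faceSize Δ) (allSubsets n)
  ... | inj₁ dim≡0 = ∅ , empty Δ , trans (∣⊥∣≡0 n) (sym dim≡0)
  ... | inj₂ (σ , size≡dim) with T? (face Δ σ)
  ...   | yes σ∈Δ = σ , σ∈Δ , trans (sym (faceSize-face σ∈Δ)) size≡dim
  ...   | no  σ∉Δ = ∅ , empty Δ , trans (∣⊥∣≡0 n) (trans (sym (faceSize-nonface σ∉Δ)) size≡dim)

  maximumFace⇒facet : ∀ {σ} → IsFace Δ σ → ∣ σ ∣ ≡ dimPlus1 Δ → IsFacet Δ σ
  maximumFace⇒facet σ∈Δ size = σ∈Δ , λ τ σ⊆τ τ∈Δ →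
    ⊆-antisym (⊆∧∣q∣≤∣p∣⇒q⊆p σ⊆τ (≤-trans (∣face∣≤dimPlus1 τ∈Δ) (≤-reflexive (sym size)))) σ⊆τ

  module _ (pure : Pure Δ) {F : Subset n} (F-facet : IsFacet Δ F) where

    ∣facet∣≡dimPlus1 : ∣ F ∣ ≡ dimPlus1 Δ
    ∣facet∣≡dimPlus1 with face-of-size-dimPlus1
    ... | σ , σ∈Δ , size = trans (pure F σ F-facet (maximumFace⇒facet σ∈Δ size)) size

    codim≡∣∁facet∣ : codim Δ ≡ ∣ ∁ F ∣
    codim≡∣∁facet∣ = trans (cong (n ∸_) (sym ∣facet∣≡dimPlus1)) (sym (∣∁p∣≡n∸∣p∣ F))

    codim≤count-exchanges : ∀ w (b : Subset n → Bool) →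
      (∀ u → u ∉ F → T (b (exchange F w u))) → codim Δ ≤ count b
    codim≤count-exchanges w b exchange∈b =
      subst (_≤ count b) (sym codim≡∣∁facet∣) (∣∁p∣≤count-exchanges F w b exchange∈b)

    codim≤antifacetsContaining : ∀ {w} → (∀ u → u ∉ F → IsAntifacet Δ (exchange F w u)) →
      ∀ {v} → v ∈ F → v ≢ w → codim Δ ≤ antifacetsContaining Δ v
    codim≤antifacetsContaining {w} antifacets v∈F v≢w =
      codim≤count-exchanges w _ λ u u∉F →
        T-∧-intro (isAntifacetᵇ-complete (antifacets u u∉F))
                  (containsᵇ-∈ (x∈p∪q⁺ (inj₁ (x∈p∧x≢y⇒x∈p-y v∈F v≢w))))

    codim≤antifacetsAvoiding : ∀ {x} → x ∈ F → (∀ y → y ∉ F → ¬ IsFace Δ (exchange F x y)) →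
      codim Δ ≤ count (λ σ → isAntifacetᵇ Δ σ ∧ not (containsᵇ Δ x σ))
    codim≤antifacetsAvoiding {x} x∈F nonfaces =
      codim≤count-exchanges x _ λ y y∉F →
        T-∧-intro (isAntifacetᵇ-complete (trans (∣exchange∣≡∣p∣ F x∈F y∉F) ∣facet∣≡dimPlus1 , nonfaces y y∉F))
                  (containsᵇ-∉ (x∉exchange F λ { refl → y∉F x∈F }))

  manyAntifacets⇒shedding : Pure Δ → suc (antifacetCount Δ) ≤ 2 * codim Δ →
    ∀ x → codim Δ ≤ antifacetsContaining Δ x → IsSheddingVertex Δ x
  manyAntifacets⇒shedding pure bound x many F F-facet x∈F
    with Fin.any? (λ y → ¬? (y ∈? F) ×-dec T? (face Δ (exchange F x y)))
  ... | yes exchange-face = exchange-face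
  ... | no  none          = contradiction (≤-trans bound 2*codim≤antifacetCount) (<-irrefl refl)
    where
    open ≤-Reasoning
    c : ℕ
    c = codim Δ
    2*codim≤antifacetCount : 2 * c ≤ antifacetCount Δ
    2*codim≤antifacetCount = begin
      2 * c
        ≡⟨ cong (c +_) (+-identityʳ c) ⟩
      c + c
        ≤⟨ +-mono-≤ many (codim≤antifacetsAvoiding pure F-facet x∈F λ y y∉F face → none (y , y∉F , face)) ⟩
      antifacetsContaining Δ x + count (λ σ → isAntifacetᵇ Δ σ ∧ not (containsᵇ Δ x σ))
        ≡⟨ sym (antifacetCount-split x) ⟩
      antifacetCount Δ ∎

lemma3p6 : ∀ {n} (Δ : SimplicialComplex n) → Pure Δ →
    suc (antifacetCount Δ) ≤ 2 * codim Δ →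
    (∀ (x : Fin n) → codim Δ ≤ antifacetsContaining Δ x → IsSheddingVertex Δ x)
    × (∀ (w : Fin n) → ¬ IsSheddingVertex Δ w →
        ∀ F → IsFacet Δ F → w ∈ F →
        (∀ u → u ∉ F → IsAntifacet Δ ((F - w) ∪ ⁅ u ⁆)) →
        ∀ v → v ∈ F → v ≢ w →
          (codim Δ ≤ antifacetsContaining Δ v) × IsSheddingVertex Δ v)
lemma3p6 Δ pure bound = shedding , λ w _ F F-facet _ antifacets v v∈F v≢w →
    let many = codim≤antifacetsContaining Δ pure F-facet antifacets v∈F v≢w
    in many , shedding v many
  where
  shedding : ∀ x → codim Δ ≤ antifacetsContaining Δ x → IsSheddingVertex Δ x
  shedding = manyAntifacets⇒shedding Δ pure bound
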